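{- Let $r$ be a positive integer and let $F:\mathbf{Set}^r\to\mathbf{Set}$ be a decomposable $r$-sort species with composition operator $\eta$. Then for every pair $(\Omega_1,\Omega_2)$ of objects of $\mathbf{Set}^r$ with $\Omega_1\cap\Omega_2=\boldsymbol\emptyset$, \[ \eta(F[\Omega_1]\times F[\Omega_2])=\eta(F[\Omega_2]\times F[\Omega_1]). \]
   Context: $\mathbf{Set}$ is the category of finite sets and bijections. Objects of $\mathbf{Set}^r$ are $r$-tuples of finite sets; set operations on them are componentwise, and $\boldsymbol\emptyset=(\emptyset,\dots,\emptyset)$. An $r$-sort species is a functor $F:\mathbf{Set}^r\to\mathbf{Set}$. A composition operator for $F$ is a family of injective maps $\eta_{(\Omega_1,\Omega_2)}:F[\Omega_1]\times F[\Omega_2]\to F[\Omega_1\amalg\Omega_2]$, one for each disjoint pair, with the following two properties. - Naturality: $\eta_{(\tilde\Omega_1,\tilde\Omega_2)}\circ(F[f_1]\times F[f_2])=F[f_1\amalg f_2]\circ\eta_{(\Omega_1,\Omega_2)}$ for tuples of bijections $f_i:\Omega_i\to\tilde\Omega_i$. - Axiom (D1): whenever $\Omega_1\amalg\Omega_2=\Omega=\tilde\Omega_1\amalg\tilde\Omega_2$, \[ \eta(F[\Omega_1]\times F[\Omega_2])\cap\eta(F[\tilde\Omega_1]\times F[\tilde\Omega_2])=\eta(\eta(F[\Omega_{11}]\times F[\Omega_{12}])\times\eta(F[\Omega_{21}]\times F[\Omega_{22}])), \] where $\Omega_{ij}=\Omega_i\cap\tilde\Omega_j$. $\eta(A\times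 B)$ denotes the image of $A\times B$ under the relevant $\eta$-map; in particular $\eta(F[\Omega_2]\times F[\Omega_1])$ is the image under $\eta_{(\Omega_2,\Omega_1)}$. $F$ is decomposable if some $F[\Omega]\ne\emptyset$ and $F$ admits a composition operator. -}

module Defs where

open import Data.Nat using (ℕ; zero; suc)
open import Data.Bool using (Bool; true; false; _∨_; _∧_; T)
open import Data.Fin using (Fin)
open import Data.Vec using (Vec; lookup; zipWith; replicate)
open import Data.Product using (Σ; _×_; _,_; proj₁)
open import Function.Bundles using (_↔_; _⇔_; Inverse)
open import Data.Unit using (⊤)
open import Function.Construct.Identity using (↔-id)
open import Function.Construct.Composition using (_↔-∘_)
open import Relation.Binary.PropositionalEquality using (_≡_; subst)

-- Finite subsets of ℕ, in a canonical representation: a nonempty finite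
-- subset is its characteristic bit string b₀ b₁ … b_m with b_m = true.
-- Every finite subset of ℕ has exactly one representative, so equality
-- of finite sets is propositional equality _≡_.

data NE : Set where
  one : NE
  _∷_ : Bool → NE → NE

data FinSet : Set where
  ∅   : FinSet
  ⟨_⟩ : NE → FinSet

memNE : ℕ → NE → Bool
memNE zero    one     = true
memNE (suc n) one     = false
memNE zero    (b ∷ s) = b
memNE (suc n) (b ∷ s) = memNE n s

_∈ᵇ_ : ℕ → FinSet → Bool
x ∈ᵇ ∅     = false
x ∈ᵇ ⟨ s ⟩ = memNE x s

cons : Bool → FinSet → FinSet
cons false ∅     = ∅
cons true  ∅     = ⟨ one ⟩
cons b     ⟨ s ⟩ = ⟨ b ∷ s ⟩

unionNE : NE → NE → NE
unionNE one     one     = one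
unionNE one     (b ∷ t) = true ∷ t
unionNE (a ∷ s) one     = true ∷ s
unionNE (a ∷ s) (b ∷ t) = (a ∨ b) ∷ unionNE s t

interNE : NE → NE → FinSet
interNE one     one     = ⟨ one ⟩
interNE one     (b ∷ t) = cons b ∅
interNE (a ∷ s) one     = cons a ∅
interNE (a ∷ s) (b ∷ t) = cons (a ∧ b) (interNE s t)

_∪ˢ_ : FinSet → FinSet → FinSet
∅     ∪ˢ t     = t
⟨ s ⟩ ∪ˢ ∅     = ⟨ s ⟩
⟨ s ⟩ ∪ˢ ⟨ t ⟩ = ⟨ unionNE s t ⟩

_∩ˢ_ : FinSet → FinSet → FinSet
∅     ∩ˢ t     = ∅
⟨ s ⟩ ∩ˢ ∅     = ∅
⟨ s ⟩ ∩ˢ ⟨ t ⟩ = interNE s t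

El : FinSet → Set
El Ω = Σ ℕ (λ x → T (x ∈ᵇ Ω))

-- The category Set^r: objects are r-tuples of finite sets,
-- morphisms are r-tuples of bijections.

Obj : ℕ → Set
Obj r = Vec FinSet r

_∪_ : ∀ {r} → Obj r → Obj r → Obj r
_∪_ = zipWith _∪ˢ_

_∩_ : ∀ {r} → Obj r → Obj r → Obj r
_∩_ = zipWith _∩ˢ_

𝟘 : ∀ {r} → Obj r
𝟘 = replicate _ ∅

Disjoint : ∀ {r} → Obj r → Obj r → Set
Disjoint Ω₁ Ω₂ = Ω₁ ∩ Ω₂ ≡ 𝟘

record Hom {r} (Ω Ω′ : Obj r) : Set where
  constructor hom
  field
    comp : (i : Fin r) → El (lookup Ω i) ↔ El (lookup Ω′ i)

open Hom public

idH : ∀ {r} (Ω : Obj r) → Hom Ω Ω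
idH Ω = hom (λ i → ↔-id _)

_∘H_ : ∀ {r} {Ω Ω′ Ω″ : Obj r} → Hom Ω′ Ω″ → Hom Ω Ω′ → Hom Ω Ω″
g ∘H f = hom (λ i → comp g i ↔-∘ comp f i)

app : ∀ {r} {Ω Ω′ : Obj r} → Hom Ω Ω′ → (i : Fin r) → El (lookup Ω i) → El (lookup Ω′ i)
app f i = Inverse.to (comp f i)

-- Morphisms of Set^r are bijections, i.e. determined by their underlying
-- functions; F-cong expresses that F is well defined on them.

record Species (r : ℕ) : Set₁ where
  field
    F₀     : Obj r → Set
    finite : ∀ Ω → Σ ℕ (λ n → F₀ Ω ↔ Fin n)
    F₁     : ∀ {Ω Ω′} → Hom Ω Ω′ → F₀ Ω → F₀ Ω′
    F-id   : ∀ {Ω} (x : F₀ Ω) → F₁ (idH Ω) x ≡ x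
    F-∘    : ∀ {Ω Ω′ Ω″} (f : Hom Ω Ω′) (g : Hom Ω′ Ω″) (x : F₀ Ω) →
             F₁ (g ∘H f) x ≡ F₁ g (F₁ f x)
    F-cong : ∀ {Ω Ω′} (f g : Hom Ω Ω′) →
             (∀ i x → app f i x ≡ app g i x) →
             ∀ (x : F₀ Ω) → F₁ f x ≡ F₁ g x

open Species public

CompMap : ∀ {r} → Species r → Set
CompMap {r} F = ∀ {Ω₁ Ω₂ : Obj r} → Disjoint Ω₁ Ω₂ →
                F₀ F Ω₁ → F₀ F Ω₂ → F₀ F (Ω₁ ∪ Ω₂)

AgreesˡOn : ∀ {r} {Ω₁ Ω₂ Ω̃₁ Ω̃₂ : Obj r} →
            Hom (Ω₁ ∪ Ω₂) (Ω̃₁ ∪ Ω̃₂) → Hom Ω₁ Ω̃₁ → Set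
AgreesˡOn {r} {Ω₁} {Ω₂} f f₁ =
  ∀ (i : Fin r) (x : ℕ) (p : T (x ∈ᵇ lookup Ω₁ i))
    (q : T (x ∈ᵇ lookup (Ω₁ ∪ Ω₂) i)) →
  proj₁ (app f i (x , q)) ≡ proj₁ (app f₁ i (x , p))

AgreesʳOn : ∀ {r} {Ω₁ Ω₂ Ω̃₁ Ω̃₂ : Obj r} →
            Hom (Ω₁ ∪ Ω₂) (Ω̃₁ ∪ Ω̃₂) → Hom Ω₂ Ω̃₂ → Set
AgreesʳOn {r} {Ω₁} {Ω₂} f f₂ =
  ∀ (i : Fin r) (x : ℕ) (p : T (x ∈ᵇ lookup Ω₂ i))
    (q : T (x ∈ᵇ lookup (Ω₁ ∪ Ω₂) i)) →
  proj₁ (app f i (x , q)) ≡ proj₁ (app f₂ i (x , p))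

-- Image of A × B under η_(Ω₁,Ω₂), viewed as a subset of F[Ω] where
-- Ω = Ω₁ ∐ Ω₂ (transport along the equality Ω₁ ∪ Ω₂ ≡ Ω).
Img : ∀ {r} (F : Species r) → CompMap F → (Ω₁ Ω₂ Ω : Obj r) →
      (F₀ F Ω₁ → Set) → (F₀ F Ω₂ → Set) → F₀ F Ω → Set
Img F η Ω₁ Ω₂ Ω A B z =
  Σ (Disjoint Ω₁ Ω₂) λ d → Σ (Ω₁ ∪ Ω₂ ≡ Ω) λ e →
  Σ (F₀ F Ω₁) λ a → Σ (F₀ F Ω₂) λ b →
  A a × B b × subst (F₀ F) e (η d a b) ≡ z

Full : ∀ {A : Set} → A → Set
Full _ = ⊤

record CompositionOperator {r} (F : Species r) : Set where
  field
    η        : CompMap F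
    injective : ∀ {Ω₁ Ω₂} (d : Disjoint Ω₁ Ω₂) (a a′ : F₀ F Ω₁) (b b′ : F₀ F Ω₂) →
                η d a b ≡ η d a′ b′ → a ≡ a′ × b ≡ b′
    -- naturality: F[f₁ ∐ f₂] ∘ η = η̃ ∘ (F[f₁] × F[f₂]),
    -- where f₁ ∐ f₂ is (extensionally) any f agreeing with f₁ on Ω₁ and f₂ on Ω₂
    natural  : ∀ {Ω₁ Ω₂ Ω̃₁ Ω̃₂} (d : Disjoint Ω₁ Ω₂) (d̃ : Disjoint Ω̃₁ Ω̃₂)
                 (f₁ : Hom Ω₁ Ω̃₁) (f₂ : Hom Ω₂ Ω̃₂) (f : Hom (Ω₁ ∪ Ω₂) (Ω̃₁ ∪ Ω̃₂)) →
                 AgreesˡOn {Ω₂ = Ω₂} {Ω̃₂ = Ω̃₂} f f₁ →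
                 AgreesʳOn {Ω₁ = Ω₁} {Ω̃₁ = Ω̃₁} f f₂ →
                 ∀ a b → F₁ F f (η d a b) ≡ η d̃ (F₁ F f₁ a) (F₁ F f₂ b)
    D1       : ∀ (Ω₁ Ω₂ Ω̃₁ Ω̃₂ Ω : Obj r) →
                 Disjoint Ω₁ Ω₂ → Ω₁ ∪ Ω₂ ≡ Ω →
                 Disjoint Ω̃₁ Ω̃₂ → Ω̃₁ ∪ Ω̃₂ ≡ Ω →
                 ∀ (z : F₀ F Ω) →
                 (Img F η Ω₁ Ω₂ Ω Full Full z × Img F η Ω̃₁ Ω̃₂ Ω Full Full z)
                 ⇔ Img F η ((Ω₁ ∩ Ω̃₁) ∪ (Ω₁ ∩ Ω̃₂)) ((Ω₂ ∩ Ω̃₁) ∪ (Ω₂ ∩ Ω̃₂)) Ω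
                     (Img F η (Ω₁ ∩ Ω̃₁) (Ω₁ ∩ Ω̃₂) _ Full Full)
                     (Img F η (Ω₂ ∩ Ω̃₁) (Ω₂ ∩ Ω̃₂) _ Full Full)
                     z

open CompositionOperator public

module Submission where

-- Let z = η(a, b) with a ∈ F[Ω₁], b ∈ F[Ω₂].  Apply axiom (D1)
-- to the two decompositions (Ω₁, Ω₂) and (Ω₂, Ω₁) of Ω = Ω₁ ∐ Ω₂.  The
-- four pieces are Ω₁∩Ω₂ = ∅, Ω₁∩Ω₁ = Ω₁, Ω₂∩Ω₂ = Ω₂, Ω₂∩Ω₁ = ∅, so (D1)
-- says: z lies in both images as soon as z ∈ η(η(F[∅] × F[Ω₁]) × η(F[Ω₂] × F[∅])).
-- This holds because of a unit law: F[∅] is inhabited (apply (D1) to the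
-- decomposition (Ω₁, Ω₂) against itself; a piece F[Ω₁∩Ω₂] = F[∅] appears),
-- and for e ∈ F[∅] the map η(e, –) : F[A] → F[A] is injective, hence, F[A]
-- being finite, surjective; so η(F[∅] × F[A]) is all of F[A].

open import Defs
open import Data.Nat using (ℕ; _≤_; suc)
open import Data.Nat.Properties using (1+n≰n)
open import Data.Bool using (true; false)
open import Data.Bool.Properties using (∨-comm; ∧-comm)
open import Data.Fin using (Fin; punchOut)
open import Data.Fin.Properties using (any?; punchOut-injective; injective⇒≤) renaming (_≟_ to _≟ᶠ_)
open import Data.Vec.Properties using (zipWith-comm; zipWith-idem; zipWith-identityˡ; zipWith-identityʳ; zipWith-zeroˡ; zipWith-zeroʳ)
open import Data.Product using (Σ; ∃; _,_; proj₁; proj₂)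
open import Data.Unit using (tt)
open import Function.Bundles using (_⇔_; _↔_; Inverse; Equivalence; mk⇔)
open import Function.Definitions using (Injective)
open import Relation.Nullary using (yes; no; contradiction)
open import Relation.Binary.PropositionalEquality

Onto : ∀ {A B : Set} → (A → B) → Set
Onto {A} h = ∀ y → ∃ λ (x : A) → h x ≡ y

unionNE-comm : ∀ s t → unionNE s t ≡ unionNE t s
unionNE-comm one     one     = refl
unionNE-comm one     (b ∷ t) = refl
unionNE-comm (a ∷ s) one     = refl
unionNE-comm (a ∷ s) (b ∷ t) = cong₂ _∷_ (∨-comm a b) (unionNE-comm s t)

interNE-comm : ∀ s t → interNE s t ≡ interNE t s
interNE-comm one     one     = refl
interNE-comm one     (b ∷ t) = refl
interNE-comm (a ∷ s) one     = refl
interNE-comm (a ∷ s) (b ∷ t) = cong₂ cons (∧-comm a b) (interNE-comm s t)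

interNE-idem : ∀ s → interNE s s ≡ ⟨ s ⟩
interNE-idem one         = refl
interNE-idem (false ∷ s) = cong (cons false) (interNE-idem s)
interNE-idem (true ∷ s)  = cong (cons true) (interNE-idem s)

∪ˢ-comm : ∀ s t → s ∪ˢ t ≡ t ∪ˢ s
∪ˢ-comm ∅     ∅     = refl
∪ˢ-comm ∅     ⟨ t ⟩ = refl
∪ˢ-comm ⟨ s ⟩ ∅     = refl
∪ˢ-comm ⟨ s ⟩ ⟨ t ⟩ = cong ⟨_⟩ (unionNE-comm s t)

∩ˢ-comm : ∀ s t → s ∩ˢ t ≡ t ∩ˢ s
∩ˢ-comm ∅     ∅     = refl
∩ˢ-comm ∅     ⟨ t ⟩ = refl
∩ˢ-comm ⟨ s ⟩ ∅     = refl
∩ˢ-comm ⟨ s ⟩ ⟨ t ⟩ = interNE-comm s t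

∩ˢ-idem : ∀ s → s ∩ˢ s ≡ s
∩ˢ-idem ∅     = refl
∩ˢ-idem ⟨ s ⟩ = interNE-idem s

∪ˢ-identityʳ : ∀ s → s ∪ˢ ∅ ≡ s
∪ˢ-identityʳ ∅     = refl
∪ˢ-identityʳ ⟨ s ⟩ = refl

∩ˢ-zeroʳ : ∀ s → s ∩ˢ ∅ ≡ ∅
∩ˢ-zeroʳ ∅     = refl
∩ˢ-zeroʳ ⟨ s ⟩ = refl

module _ {r : ℕ} where

  ∪-comm : (A B : Obj r) → A ∪ B ≡ B ∪ A
  ∪-comm = zipWith-comm ∪ˢ-comm

  ∩-comm : (A B : Obj r) → A ∩ B ≡ B ∩ A
  ∩-comm = zipWith-comm ∩ˢ-comm

  ∩-idem : (A : Obj r) → A ∩ A ≡ A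
  ∩-idem = zipWith-idem ∩ˢ-idem

  ∪-identityˡ : (A : Obj r) → 𝟘 ∪ A ≡ A
  ∪-identityˡ = zipWith-identityˡ (λ _ → refl)

  ∪-identityʳ : (A : Obj r) → A ∪ 𝟘 ≡ A
  ∪-identityʳ = zipWith-identityʳ ∪ˢ-identityʳ

  ∩-zeroˡ : (A : Obj r) → 𝟘 ∩ A ≡ 𝟘
  ∩-zeroˡ = zipWith-zeroˡ (λ _ → refl)

  ∩-zeroʳ : (A : Obj r) → A ∩ 𝟘 ≡ 𝟘
  ∩-zeroʳ = zipWith-zeroʳ ∩ˢ-zeroʳ

  pieces-∅-A : ∀ {A B : Obj r} → Disjoint A B → (A ∩ B) ∪ (A ∩ A) ≡ A
  pieces-∅-A {A} {B} d = begin
    (A ∩ B) ∪ (A ∩ A) ≡⟨ cong₂ _∪_ d (∩-idem A) ⟩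
    𝟘 ∪ A             ≡⟨ ∪-identityˡ A ⟩
    A                 ∎
    where open ≡-Reasoning

  pieces-A-∅ : ∀ {A B : Obj r} → Disjoint A B → (A ∩ A) ∪ (A ∩ B) ≡ A
  pieces-A-∅ {A} {B} d = begin
    (A ∩ A) ∪ (A ∩ B) ≡⟨ cong₂ _∪_ (∩-idem A) d ⟩
    A ∪ 𝟘             ≡⟨ ∪-identityʳ A ⟩
    A                 ∎
    where open ≡-Reasoning

-- For Fin n: a map missing some y factors through Fin n ∖ {y} ≅ Fin (n-1)
-- via punchOut, and an injection Fin n → Fin (n-1) cannot exist.
Fin-injective⇒onto : ∀ {n} (f : Fin n → Fin n) → Injective _≡_ _≡_ f → Onto f
Fin-injective⇒onto {suc m} f f-inj y with any? (λ x → f x ≟ᶠ y)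
... | yes hit  = hit
... | no  miss = contradiction (injective⇒≤ squeeze-inj) (1+n≰n {m})
  where
  y≢f : ∀ x → y ≢ f x
  y≢f x y≡fx = miss (x , sym y≡fx)

  squeeze : Fin (suc m) → Fin m
  squeeze x = punchOut (y≢f x)

  squeeze-inj : Injective _≡_ _≡_ squeeze
  squeeze-inj {x} {x′} eq = f-inj (punchOut-injective (y≢f x) (y≢f x′) eq)

-- Transported along a bijection A ↔ Fin n: h read in the coordinates Fin n
-- is an injective endomap of Fin n.
finite-injective⇒onto : ∀ {A : Set} {n} → A ↔ Fin n →
                        (h : A → A) → Injective _≡_ _≡_ h → Onto h
finite-injective⇒onto {A} iso h h-inj y =
  let (k , fk≡y) = Fin-injective⇒onto f f-inj (to y)
  in from k , to-injective fk≡y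
  where
  open Inverse iso using (to; from)

  from∘to : ∀ x → from (to x) ≡ x
  from∘to = Inverse.strictlyInverseʳ iso

  to∘from : ∀ k → to (from k) ≡ k
  to∘from = Inverse.strictlyInverseˡ iso

  to-injective : Injective _≡_ _≡_ to
  to-injective {x} {x′} eq = trans (sym (from∘to x)) (trans (cong from eq) (from∘to x′))

  f : Fin _ → Fin _
  f k = to (h (from k))

  f-inj : Injective _≡_ _≡_ f
  f-inj {k} {k′} eq = begin
    k             ≡⟨ to∘from k ⟨
    to (from k)   ≡⟨ cong to (h-inj (to-injective eq)) ⟩
    to (from k′)  ≡⟨ to∘from k′ ⟩
    k′            ∎
    where open ≡-Reasoning

module _ {r : ℕ} (F : Species r) (C : CompositionOperator F) where

  private
    F₀′ : Obj r → Set
    F₀′ = F₀ F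

  relabel : ∀ {Ω₁ Ω₂ X Y Ω : Obj r} {z : F₀′ Ω}
              {A : F₀′ X → Set} {B : F₀′ Y → Set} →
            Ω₁ ≡ X → Ω₂ ≡ Y → (∀ a → A a) → (∀ b → B b) →
            Img F (η C) Ω₁ Ω₂ Ω Full Full z → Img F (η C) X Y Ω A B z
  relabel refl refl all-A all-B (d , e , a , b , _ , _ , η≡z) =
    d , e , a , b , all-A a , all-B b , η≡z

  -- Unit law: for ε ∈ F[∅], η(ε, –) : F[A] → F[∅ ∪ A] = F[A] is injective,
  -- hence onto because F[A] is finite.  The same holds for η(–, ε).
  left-unit : ∀ {A₀ A₁ : Obj r} → A₀ ≡ 𝟘 → F₀′ 𝟘 →
              ∀ x → Img F (η C) A₀ A₁ (A₀ ∪ A₁) Full Full x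
  left-unit {A₁ = A} refl ε x =
    let (a , ha≡x) = finite-injective⇒onto (proj₂ (finite F A)) h h-inj (subst F₀′ ∅∪A≡A x)
    in d , refl , ε , a , tt , tt , subst-injective ∅∪A≡A ha≡x
    where
    d : Disjoint 𝟘 A
    d = ∩-zeroˡ A
    ∅∪A≡A : 𝟘 ∪ A ≡ A
    ∅∪A≡A = ∪-identityˡ A
    h : F₀′ A → F₀′ A
    h a = subst F₀′ ∅∪A≡A (η C d ε a)
    h-inj : Injective _≡_ _≡_ h
    h-inj eq = proj₂ (injective C d ε ε _ _ (subst-injective ∅∪A≡A eq))

  right-unit : ∀ {A₀ A₁ : Obj r} → A₁ ≡ 𝟘 → F₀′ 𝟘 →
               ∀ x → Img F (η C) A₀ A₁ (A₀ ∪ A₁) Full Full x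
  right-unit {A₀ = A} refl ε x =
    let (a , ha≡x) = finite-injective⇒onto (proj₂ (finite F A)) h h-inj (subst F₀′ A∪∅≡A x)
    in d , refl , a , ε , tt , tt , subst-injective A∪∅≡A ha≡x
    where
    d : Disjoint A 𝟘
    d = ∩-zeroʳ A
    A∪∅≡A : A ∪ 𝟘 ≡ A
    A∪∅≡A = ∪-identityʳ A
    h : F₀′ A → F₀′ A
    h a = subst F₀′ A∪∅≡A (η C d a ε)
    h-inj : Injective _≡_ _≡_ h
    h-inj eq = proj₁ (injective C d _ _ ε ε (subst-injective A∪∅≡A eq))

  -- F[∅] is inhabited as soon as some element decomposes: (D1) applied to a
  -- decomposition (Ω₁, Ω₂) against itself produces a factor in F[Ω₁ ∩ Ω₂].
  empty-inhabited : ∀ {Ω₁ Ω₂ Ω : Obj r} {z : F₀′ Ω} →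
                    Img F (η C) Ω₁ Ω₂ Ω Full Full z → F₀′ 𝟘
  empty-inhabited {Ω₁} {Ω₂} {Ω} {z} img@(d , e , _)
    with Equivalence.to (D1 C Ω₁ Ω₂ Ω₁ Ω₂ Ω d e d e z) (img , img)
  ... | _ , _ , _ , _ , (_ , _ , _ , c , _) , _ = subst F₀′ d c

  -- The factors of an image can be swapped: by (D1) for (Ω₁, Ω₂) against
  -- (Ω₂, Ω₁) it suffices that z ∈ η(η(F[∅] × F[Ω₁]) × η(F[Ω₂] × F[∅])),
  -- which is z ∈ η(F[Ω₁] × F[Ω₂]) rewritten by the unit laws.
  swap-image : ∀ {Ω₁ Ω₂ Ω : Obj r} {z : F₀′ Ω} →
               Img F (η C) Ω₁ Ω₂ Ω Full Full z → Img F (η C) Ω₂ Ω₁ Ω Full Full z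
  swap-image {Ω₁} {Ω₂} {Ω} {z} img@(d , e , _) =
    proj₂ (Equivalence.from (D1 C Ω₁ Ω₂ Ω₂ Ω₁ Ω d e d′ e′ z) in-pieces)
    where
    d′ : Disjoint Ω₂ Ω₁
    d′ = trans (∩-comm Ω₂ Ω₁) d
    e′ : Ω₂ ∪ Ω₁ ≡ Ω
    e′ = trans (∪-comm Ω₂ Ω₁) e
    ε : F₀′ 𝟘
    ε = empty-inhabited img
    in-pieces : Img F (η C) ((Ω₁ ∩ Ω₂) ∪ (Ω₁ ∩ Ω₁)) ((Ω₂ ∩ Ω₂) ∪ (Ω₂ ∩ Ω₁)) Ω
                  (Img F (η C) (Ω₁ ∩ Ω₂) (Ω₁ ∩ Ω₁) _ Full Full)
                  (Img F (η C) (Ω₂ ∩ Ω₂) (Ω₂ ∩ Ω₁) _ Full Full) z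
    in-pieces = relabel (sym (pieces-∅-A d)) (sym (pieces-A-∅ d′))
                        (left-unit d ε) (right-unit d′ ε) img

-- Membership in
-- an image already records the disjointness it needs, and the inhabitant of
-- F[∅] comes from z itself.

lemma3p2 : (r : ℕ) → 1 ≤ r → (F : Species r) → (C : CompositionOperator F) →
    Σ (Obj r) (λ Ω → F₀ F Ω) →
    ∀ (Ω₁ Ω₂ : Obj r) → Disjoint Ω₁ Ω₂ →
    ∀ (z : F₀ F (Ω₁ ∪ Ω₂)) →
    Img F (η C) Ω₁ Ω₂ (Ω₁ ∪ Ω₂) Full Full z ⇔ Img F (η C) Ω₂ Ω₁ (Ω₁ ∪ Ω₂) Full Full z
lemma3p2 r _ F C _ Ω₁ Ω₂ _ z = mk⇔ (swap-image F C) (swap-image F C)
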